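{- For every integer $k \geq 3$, every graph $H \in \mathcal{H}_k$ is Hamiltonian but not cycle extendible.
   Context: For an integer $k \geq 1$, $G_k := K_k \vee P_{2k+1}$ is the join of a complete graph on vertices $x_1, \ldots, x_k$ with a path on $2k+1$ vertices whose vertices, in order along the path, are $u_1, u_2, \ldots, u_k, z, v_k, v_{k-1}, \ldots, v_1$ (every $x_i$ is adjacent to every path vertex and to every other $x_j$). The heavy edges of $G_k$ are $A_k = \{x_iu_i : 1 \leq i \leq k\} \cup \{x_iv_i : 1 \leq i \leq k-1\}$. Pasting a clique of order $r \geq 3$ onto an edge $ab$ means adding $r-2$ new vertices that are pairwise adjacent and each adjacent to both $a$ and $b$. $\mathcal{H}_k$ is the family of all graphs obtained from $G_k$ by pasting, onto each heavy edge in $A_k$, a clique (of any order at least $3$, possibly different for different edges), the new vertices for different heavy edges being distinct. A graph $G$ is cycle extendible if for every non-Hamiltonian cycle $C$ of $G$ there is a cycle $C'$ of $G$ with $V(C) \subset V(C')$ and $|V(C')| = |V(C)| + 1$. -}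

module Defs where

open import Level using (0ℓ)
open import Data.Nat using (ℕ; zero; suc; _≤_; _<_)
open import Data.Fin using (Fin; toℕ)
open import Data.List using (List; []; _∷_; _++_; [_]; length)
open import Data.List.Membership.Propositional using (_∈_)
open import Data.List.Relation.Unary.Unique.Propositional using (Unique)
open import Data.List.Relation.Unary.Linked using (Linked)
open import Data.Product using (_×_; ∃)
open import Data.Sum using (_⊎_)
open import Data.Empty using (⊥)
open import Relation.Nullary using (¬_)
open import Relation.Binary.PropositionalEquality using (_≡_)

-- Graphs: a vertex type with an adjacency relation (the graphs below are
-- finite and their adjacency is symmetric and irreflexive by construction).

record Graph : Set₁ where
  field
    V : Set
    E : V → V → Set

module _ (G : Graph) where
  open Graph G

  -- Its vertex set V(C) is the set of list elements.
  IsCycle : List V → Set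
  IsCycle []       = ⊥
  IsCycle (v ∷ ws) = (3 ≤ length (v ∷ ws)) × Unique (v ∷ ws) × Linked E (v ∷ ws ++ [ v ])

  Spanning : List V → Set
  Spanning vs = ∀ w → w ∈ vs

  Hamiltonian : Set
  Hamiltonian = ∃ λ vs → IsCycle vs × Spanning vs

  -- Every non-Hamiltonian cycle C extends to a cycle C' with V(C) ⊂ V(C')
  -- and |V(C')| = |V(C)| + 1 (vertices of a cycle are distinct, so |V(C)| is
  -- the length of the list).
  CycleExtendible : Set
  CycleExtendible =
    ∀ vs → IsCycle vs → ¬ Spanning vs →
    ∃ λ ws → IsCycle ws × (∀ w → w ∈ vs → w ∈ ws) × (length ws ≡ suc (length vs))

-- Indices i : Fin k stand for 1 + toℕ i ∈ {1,…,k}.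
-- a i   = (order of the clique pasted on x_i u_i) - 2   (≥ 1)
-- b i h = (order of the clique pasted on x_i v_i) - 2   (≥ 1), defined only
--         for heavy edges x_i v_i, i.e. i ≤ k-1, i.e. suc (toℕ i) < k.

module HGraph (k : ℕ) (a : Fin k → ℕ) (b : (i : Fin k) → suc (toℕ i) < k → ℕ) where

  data Vtx : Set where
    x  : Fin k → Vtx
    u  : Fin k → Vtx
    z  : Vtx
    v  : Fin k → Vtx
    cu : (i : Fin k) → Fin (a i) → Vtx
    cv : (i : Fin k) (h : suc (toℕ i) < k) → Fin (b i h) → Vtx

  -- one orientation of each edge
  data Base : Vtx → Vtx → Set where
    xx   : ∀ {i j} → toℕ i < toℕ j → Base (x i) (x j)
    xu   : ∀ i j → Base (x i) (u j)
    xz   : ∀ i → Base (x i) z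
    xv   : ∀ i j → Base (x i) (v j)
    -- path u_1 … u_k z v_k … v_1
    uu   : ∀ {i j} → suc (toℕ i) ≡ toℕ j → Base (u i) (u j)
    uz   : ∀ {i} → suc (toℕ i) ≡ k → Base (u i) z
    zv   : ∀ {j} → suc (toℕ j) ≡ k → Base z (v j)
    vv   : ∀ {i j} → suc (toℕ i) ≡ toℕ j → Base (v j) (v i)
    cucu : ∀ {i p q} → toℕ p < toℕ q → Base (cu i p) (cu i q)
    cux  : ∀ {i p} → Base (cu i p) (x i)
    cuu  : ∀ {i p} → Base (cu i p) (u i)
    cvcv : ∀ {i h p q} → toℕ p < toℕ q → Base (cv i h p) (cv i h q)
    cvx  : ∀ {i h p} → Base (cv i h p) (x i)
    cvv  : ∀ {i h p} → Base (cv i h p) (v i)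

  Adj : Vtx → Vtx → Set
  Adj s t = Base s t ⊎ Base t s

H : (k : ℕ) (a : Fin k → ℕ) (b : (i : Fin k) → suc (toℕ i) < k → ℕ) → Graph
H k a b = record { V = HGraph.Vtx k a b ; E = HGraph.Adj k a b }

-- Let K(x_i u_i), K(x_i v_i) be the pasted cliques.  H has the Hamiltonian cycle
-- x_k K(x_k u_k) u_k z v_k followed, for i = k-1, …, 1, by blocks u_i K(x_i u_i) x_i K(x_i v_i) v_i
-- traversed in alternating directions; deleting z and v_k leaves a cycle C.  A cycle through a
-- pasted clique K(pq) and some vertex outside K ∪ {p, q} traverses K in one segment from p to q, so
-- on any cycle C′ ⊇ C each x_i with i < k has both cycle-neighbours in its two cliques.  If
-- |C′| = |C| + 1 then C′ contains exactly one of z and v_k.  With z, the neighbours of z must be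
-- x_k and u_k, and z, x_k, u_k, K(x_k u_k) close up into a cycle missing u_1.  With v_k, its
-- neighbours must be x_k and v_{k-1}, u_k must continue to u_{k-1}, and the vertices of levels k
-- and k-1 close up into a cycle, again missing u_1.

module Submission where

open import Defs
open import Level using (0ℓ)
open import Function using (_∘_)
open import Data.Nat using (ℕ; zero; suc; _+_; _≤_; _<_; s≤s; z≤n)
open import Data.Nat.Properties
  using (≤-refl; ≤-trans; ≤-reflexive; <-trans; n<1+n; <⇒≢; <-irrelevant; 1+n≰n; m≤n⇒m<n∨m≡n; m≤n⇒m≤1+n; m<n⇒m<1+n; ≤-pred; suc-injective)
open import Data.Fin using (Fin; toℕ; fromℕ; fromℕ<; _≟_) renaming (zero to fzero; suc to fsuc)
open import Data.Fin.Properties using (toℕ-fromℕ; toℕ-fromℕ<; toℕ-injective; toℕ<n)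
open import Data.List using (List; []; _∷_; _++_; [_]; length; tabulate)
open import Data.List.Properties using (++-assoc)
open import Data.List.Membership.Propositional using (_∈_; _─_)
open import Data.List.Membership.Propositional.Properties using (∈-++⁺ˡ; ∈-++⁺ʳ; ∈-++⁻; ∈-tabulate⁺)
open import Data.List.Relation.Unary.Any using (here; there)
open import Data.List.Relation.Binary.Subset.Propositional using (_⊆_)
open import Data.List.Relation.Unary.All using (All; []; _∷_)
import Data.List.Relation.Unary.All as All
import Data.List.Relation.Unary.All.Properties as All
open import Data.List.Relation.Unary.Unique.Propositional using (Unique; []; _∷_)
import Data.List.Relation.Unary.Unique.Propositional.Properties as Unique
import Data.List.Relation.Unary.AllPairs as AllPairs
open import Data.List.Relation.Unary.Linked using (Linked; [-]; _∷_)
open import Data.Product using (_×_; _,_; ∃; proj₁; proj₂)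
open import Data.Sum using (_⊎_; inj₁; inj₂)
import Data.Sum as Sum
open import Data.Empty using (⊥; ⊥-elim)
open import Relation.Nullary using (¬_; yes; no)
open import Relation.Unary using (Pred; Decidable)
open import Relation.Binary.PropositionalEquality using (_≡_; _≢_; refl; sym; trans; cong; subst; module ≡-Reasoning)

module _ {A : Set} where

  ∈-─⁺ : ∀ {x y : A} {xs} (x∈xs : x ∈ xs) → y ∈ xs → x ≢ y → y ∈ xs ─ x∈xs
  ∈-─⁺ (here refl) (here refl) x≢y = ⊥-elim (x≢y refl)
  ∈-─⁺ (here _)    (there y∈)  _   = y∈
  ∈-─⁺ (there x∈)  (here refl) _   = here refl
  ∈-─⁺ (there x∈)  (there y∈)  x≢y = there (∈-─⁺ x∈ y∈ x≢y)

  length-─ : ∀ {x : A} xs (x∈xs : x ∈ xs) → length xs ≡ suc (length (xs ─ x∈xs))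
  length-─ (_ ∷ _)  (here _)   = refl
  length-─ (_ ∷ xs) (there x∈) = cong suc (length-─ xs x∈)

  Unique-⊆⇒length≤ : ∀ {xs ys : List A} → Unique xs → xs ⊆ ys → length xs ≤ length ys
  Unique-⊆⇒length≤ {[]}     _          _  = z≤n
  Unique-⊆⇒length≤ {x ∷ xs} {ys} (x∉ ∷ u) xs⊆ys =
    subst (suc (length xs) ≤_) (sym (length-─ ys x∈ys))
      (s≤s (Unique-⊆⇒length≤ u λ w∈ → ∈-─⁺ x∈ys (xs⊆ys (there w∈)) (All.lookup x∉ w∈)))
    where x∈ys = xs⊆ys (here refl)

  Unique-++-separatedBy : ∀ {B : Set} (f : A → B) {c xs ys} →
    All ((_≡ c) ∘ f) xs → All ((_≢ c) ∘ f) ys → Unique xs → Unique ys → Unique (xs ++ ys)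
  Unique-++-separatedBy f fxs fys uxs uys =
    Unique.++⁺ uxs uys λ (w∈xs , w∈ys) → All.lookup fys w∈ys (All.lookup fxs w∈xs)

  three≤length : ∀ (xs : List A) {w y y′ ys} → 3 ≤ length (w ∷ xs ++ y ∷ y′ ∷ ys)
  three≤length []           = s≤s (s≤s (s≤s z≤n))
  three≤length (_ ∷ xs) {w} = m≤n⇒m≤1+n (three≤length xs {w})

  Linked-clique : ∀ (R : A → A → Set) {n} (f : Fin n → A) {a b rest} →
    (∀ p → R a (f p)) → (∀ p → R (f p) b) → (∀ p q → toℕ p < toℕ q → R (f p) (f q)) → R a b →
    Linked R (b ∷ rest) → Linked R (a ∷ tabulate f ++ b ∷ rest)
  Linked-clique R {zero}  f Raf Rfb Rff Rab Rb = Rab ∷ Rb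
  Linked-clique R {suc n} f Raf Rfb Rff Rab Rb =
    Raf fzero ∷ Linked-clique R (f ∘ fsuc) (λ p → Rff fzero (fsuc p) (s≤s z≤n)) (Rfb ∘ fsuc)
                  (λ p q p<q → Rff (fsuc p) (fsuc q) (s≤s p<q)) (Rfb fzero) Rb

  data Consecutive : List A → A → A → Set where
    here  : ∀ {x y l} → Consecutive (x ∷ y ∷ l) x y
    there : ∀ {x l a b} → Consecutive l a b → Consecutive (x ∷ l) a b

  Consecutive⇒related : ∀ {R : A → A → Set} {l a b} → Linked R l → Consecutive l a b → R a b
  Consecutive⇒related (Rab ∷ _) here      = Rab
  Consecutive⇒related (_ ∷ Rl)  (there c) = Consecutive⇒related Rl c

  Consecutive-∷ʳ-source : ∀ l {e a b} → Consecutive (l ++ [ e ]) a b → a ∈ l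
  Consecutive-∷ʳ-source []          (there ())
  Consecutive-∷ʳ-source (x ∷ [])    here              = here refl
  Consecutive-∷ʳ-source (x ∷ [])    (there (there ()))
  Consecutive-∷ʳ-source (x ∷ y ∷ l) here              = here refl
  Consecutive-∷ʳ-source (x ∷ y ∷ l) (there c)         = there (Consecutive-∷ʳ-source (y ∷ l) c)

  Consecutive-∷-target : ∀ {e} l {a b} → Consecutive (e ∷ l) a b → b ∈ l
  Consecutive-∷-target (y ∷ l) here      = here refl
  Consecutive-∷-target (y ∷ l) (there c) = there (Consecutive-∷-target l c)

  successor : ∀ l {e a} → a ∈ l → ∃ λ b → Consecutive (l ++ [ e ]) a b
  successor (x ∷ [])    {e} (here refl) = e , here
  successor (x ∷ y ∷ l)     (here refl) = y , here
  successor (x ∷ y ∷ l)     (there a∈)  with successor (y ∷ l) a∈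
  ... | b , c = b , there c

  predecessor : ∀ {e} l {b} → b ∈ l → ∃ λ a → Consecutive (e ∷ l) a b
  predecessor {e} (y ∷ l) (here refl) = e , here
  predecessor     (y ∷ l) (there b∈)  with predecessor l b∈
  ... | a , c = a , there c

  successor-unique : ∀ l {e a b b′} → Unique l →
    Consecutive (l ++ [ e ]) a b → Consecutive (l ++ [ e ]) a b′ → b ≡ b′
  successor-unique []          _        (there ()) _
  successor-unique (x ∷ [])    _        here      here                = refl
  successor-unique (x ∷ [])    _        here      (there (there ()))
  successor-unique (x ∷ [])    _        (there (there ())) _
  successor-unique (x ∷ y ∷ l) _        here      here                = refl
  successor-unique (x ∷ y ∷ l) (x∉ ∷ _) here      (there c)           =
    ⊥-elim (All.lookup x∉ (Consecutive-∷ʳ-source (y ∷ l) c) refl)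
  successor-unique (x ∷ y ∷ l) (x∉ ∷ _) (there c) here                =
    ⊥-elim (All.lookup x∉ (Consecutive-∷ʳ-source (y ∷ l) c) refl)
  successor-unique (x ∷ y ∷ l) (_ ∷ u)  (there c) (there c′)          = successor-unique (y ∷ l) u c c′

  predecessor-unique : ∀ {e} l {a a′ b} → Unique l →
    Consecutive (e ∷ l) a b → Consecutive (e ∷ l) a′ b → a ≡ a′
  predecessor-unique (y ∷ l) _        here      here       = refl
  predecessor-unique (y ∷ l) (y∉ ∷ _) here      (there c)  = ⊥-elim (All.lookup y∉ (Consecutive-∷-target l c) refl)
  predecessor-unique (y ∷ l) (y∉ ∷ _) (there c) here       = ⊥-elim (All.lookup y∉ (Consecutive-∷-target l c) refl)
  predecessor-unique (y ∷ l) (_ ∷ u)  (there c) (there c′) = predecessor-unique l u c c′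

  module _ (P : Pred A 0ℓ) where

    closed⇒last : ∀ l {e w} → (∀ {a b} → Consecutive (l ++ [ e ]) a b → P a → P b) →
      w ∈ l ++ [ e ] → P w → P e
    closed⇒last []          cl (here refl)         Pw = Pw
    closed⇒last (x ∷ [])    cl (here refl)         Pw = cl here Pw
    closed⇒last (x ∷ [])    cl (there (here refl)) Pw = Pw
    closed⇒last (x ∷ y ∷ l) cl (here refl)         Pw = closed⇒last (y ∷ l) (cl ∘ there) (here refl) (cl here Pw)
    closed⇒last (x ∷ y ∷ l) cl (there w∈)          Pw = closed⇒last (y ∷ l) (cl ∘ there) w∈ Pw

    closed⇒all : ∀ x l → (∀ {a b} → Consecutive (x ∷ l) a b → P a → P b) → P x →
      ∀ {w} → w ∈ x ∷ l → P w
    closed⇒all x l       cl Px (here refl) = Px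
    closed⇒all x (y ∷ l) cl Px (there w∈)  = closed⇒all y l (cl ∘ there) (cl here Px) w∈

module OnCycle (G : Graph) (E-sym : ∀ {a b} → Graph.E G a b → Graph.E G b a)
               {v₀ : Graph.V G} {ws : List (Graph.V G)} (cycle : IsCycle G (v₀ ∷ ws)) where
  open Graph G

  C : List V
  C = v₀ ∷ ws

  C-unique : Unique C
  C-unique = proj₁ (proj₂ cycle)

  private
    three≤|C| : 3 ≤ length C
    three≤|C| = proj₁ cycle

    linked : Linked E (C ++ [ v₀ ])
    linked = proj₂ (proj₂ cycle)

    unique-rotated : Unique (ws ++ [ v₀ ])
    unique-rotated with C-unique
    ... | v₀∉ws ∷ u = Unique.++⁺ u ([] ∷ []) λ where (v₀∈ws , here refl) → All.lookup v₀∉ws v₀∈ws refl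

  infix 4 _↦_ _~_

  _↦_ : V → V → Set
  a ↦ b = Consecutive (C ++ [ v₀ ]) a b

  _~_ : V → V → Set
  a ~ b = a ↦ b ⊎ b ↦ a

  ↦⇒E : ∀ {a b} → a ↦ b → E a b
  ↦⇒E = Consecutive⇒related linked

  ~⇒E : ∀ {a b} → a ~ b → E a b
  ~⇒E (inj₁ a↦b) = ↦⇒E a↦b
  ~⇒E (inj₂ b↦a) = E-sym (↦⇒E b↦a)

  ~-sym : ∀ {a b} → a ~ b → b ~ a
  ~-sym (inj₁ a↦b) = inj₂ a↦b
  ~-sym (inj₂ b↦a) = inj₁ b↦a

  ↦-source : ∀ {a b} → a ↦ b → a ∈ C
  ↦-source = Consecutive-∷ʳ-source C

  ↦-target : ∀ {a b} → a ↦ b → b ∈ C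
  ↦-target a↦b with ∈-++⁻ ws (Consecutive-∷-target (ws ++ [ v₀ ]) a↦b)
  ... | inj₁ b∈ws        = there b∈ws
  ... | inj₂ (here refl) = here refl

  ~-target : ∀ {a b} → a ~ b → b ∈ C
  ~-target (inj₁ a↦b) = ↦-target a↦b
  ~-target (inj₂ b↦a) = ↦-source b↦a

  next : ∀ {w} → w ∈ C → ∃ (w ↦_)
  next = successor C

  prev : ∀ {w} → w ∈ C → ∃ (_↦ w)
  prev (here refl) = predecessor (ws ++ [ v₀ ]) (∈-++⁺ʳ ws (here refl))
  prev (there w∈)  = predecessor (ws ++ [ v₀ ]) (∈-++⁺ˡ w∈)

  ↦-functional : ∀ {a b b′} → a ↦ b → a ↦ b′ → b ≡ b′
  ↦-functional = successor-unique C C-unique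

  ↦-injective : ∀ {a a′ b} → a ↦ b → a′ ↦ b → a ≡ a′
  ↦-injective = predecessor-unique (ws ++ [ v₀ ]) unique-rotated

  ↦-closed⇒all : ∀ (P : Pred V 0ℓ) → (∀ {a b} → a ↦ b → P a → P b) →
    ∀ {w w′} → w ∈ C → P w → w′ ∈ C → P w′
  ↦-closed⇒all P cl w∈ Pw w′∈ =
    closed⇒all P v₀ (ws ++ [ v₀ ]) cl (closed⇒last P C cl (∈-++⁺ˡ w∈) Pw) (∈-++⁺ˡ w′∈)

  ~-closed⇒all : ∀ (P : Pred V 0ℓ) → (∀ {a b} → a ~ b → P a → P b) →
    ∀ {w w′} → w ∈ C → P w → w′ ∈ C → P w′
  ~-closed⇒all P cl = ↦-closed⇒all P (cl ∘ inj₁)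

  ↤-closed⇒all : ∀ (P : Pred V 0ℓ) → (∀ {a b} → a ↦ b → P b → P a) →
    ∀ {w w′} → w ∈ C → P w → w′ ∈ C → ¬ ¬ P w′
  ↤-closed⇒all P cl w∈ Pw w′∈ ¬Pw′ = ↦-closed⇒all (¬_ ∘ P) (λ a↦b ¬Pa Pb → ¬Pa (cl a↦b Pb)) w′∈ ¬Pw′ w∈ Pw

  ↦-asym : ∀ {a b} → a ↦ b → ¬ b ↦ a
  ↦-asym {a} {b} a↦b b↦a = 1+n≰n (≤-trans three≤|C| (Unique-⊆⇒length≤ C-unique C⊆ab))
    where
    P : Pred V 0ℓ
    P w = w ≡ a ⊎ w ≡ b
    closed : ∀ {c d} → c ↦ d → P c → P d
    closed c↦d (inj₁ refl) = inj₂ (↦-functional c↦d a↦b)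
    closed c↦d (inj₂ refl) = inj₁ (↦-functional c↦d b↦a)
    C⊆ab : ∀ {w} → w ∈ C → w ∈ a ∷ b ∷ []
    C⊆ab w∈ with ↦-closed⇒all P closed (↦-source a↦b) (inj₁ refl) w∈
    ... | inj₁ refl = here refl
    ... | inj₂ refl = there (here refl)

  ~-at-most-two : ∀ {w a b t} → w ~ a → w ~ b → a ≢ b → w ~ t → t ≡ a ⊎ t ≡ b
  ~-at-most-two (inj₁ w↦a) _          _   (inj₁ w↦t) = inj₁ (↦-functional w↦t w↦a)
  ~-at-most-two _          (inj₁ w↦b) _   (inj₁ w↦t) = inj₂ (↦-functional w↦t w↦b)
  ~-at-most-two (inj₂ a↦w) (inj₂ b↦w) a≢b (inj₁ _)   = ⊥-elim (a≢b (↦-injective a↦w b↦w))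
  ~-at-most-two (inj₂ a↦w) _          _   (inj₂ t↦w) = inj₁ (↦-injective t↦w a↦w)
  ~-at-most-two _          (inj₂ b↦w) _   (inj₂ t↦w) = inj₂ (↦-injective t↦w b↦w)
  ~-at-most-two (inj₁ w↦a) (inj₁ w↦b) a≢b (inj₂ _)   = ⊥-elim (a≢b (↦-functional w↦a w↦b))

  ~-both : ∀ {w a b} → w ∈ C → a ≢ b → (∀ {t} → w ~ t → t ≡ a ⊎ t ≡ b) → w ~ a × w ~ b
  ~-both w∈ a≢b only with next w∈ | prev w∈
  ... | s , w↦s | p , p↦w with only (inj₁ w↦s) | only (inj₂ p↦w)
  ... | inj₁ refl | inj₂ refl = inj₁ w↦s , inj₂ p↦w
  ... | inj₂ refl | inj₁ refl = inj₂ p↦w , inj₁ w↦s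
  ... | inj₁ refl | inj₁ refl = ⊥-elim (↦-asym p↦w w↦s)
  ... | inj₂ refl | inj₂ refl = ⊥-elim (↦-asym p↦w w↦s)

  ~-either : ∀ (S : Pred V 0ℓ) {w n} → w ~ n → ¬ S n → ∃ (λ t → S t × w ~ t) → ∀ {t} → w ~ t → t ≡ n ⊎ S t
  ~-either S w~n ¬Sn (t′ , St′ , w~t′) w~t with ~-at-most-two w~n w~t′ (λ { refl → ¬Sn St′ }) w~t
  ... | inj₁ t≡n  = inj₁ t≡n
  ... | inj₂ refl = inj₂ St′

  -- S is attached to the rest of the graph only at p and q, so the cycle runs through S
  -- in a single segment from p to q.
  module PastedClique (S : Pred V 0ℓ) (S? : Decidable S) {p q : V}
    (attached : ∀ {s t} → S s → E s t → S t ⊎ t ≡ p ⊎ t ≡ q)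
    (p∈C : p ∈ C) (q∈C : q ∈ C) (p∉S : ¬ S p) (q∉S : ¬ S q) (p≢q : p ≢ q)
    {s₀ : V} (s₀∈S : S s₀) (s₀∈C : s₀ ∈ C) where

    private
      S∪pq : Pred V 0ℓ
      S∪pq w = S w ⊎ w ≡ p ⊎ w ≡ q

      ∉S∪pq : ∀ {o} → ¬ S o → o ≢ p → o ≢ q → ¬ S∪pq o
      ∉S∪pq ¬So _   _   (inj₁ So)          = ¬So So
      ∉S∪pq _   o≢p _   (inj₂ (inj₁ o≡p)) = o≢p o≡p
      ∉S∪pq _   _   o≢q (inj₂ (inj₂ o≡q)) = o≢q o≡q

    p-touches-S : ¬ (∀ {t} → S t → ¬ p ~ t)
    p-touches-S p≁S with next q∈C | prev q∈C
    ... | sq , q↦sq | rq , rq↦q with S? sq | S? rq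
    ... | no ¬Ssq | _ = ↤-closed⇒all S S-backward s₀∈C s₀∈S p∈C p∉S
      where
      S-backward : ∀ {a b} → a ↦ b → S b → S a
      S-backward a↦b Sb with attached Sb (E-sym (↦⇒E a↦b))
      ... | inj₁ Sa            = Sa
      ... | inj₂ (inj₁ refl)   = ⊥-elim (p≁S Sb (inj₁ a↦b))
      ... | inj₂ (inj₂ refl)   = ⊥-elim (¬Ssq (subst S (↦-functional a↦b q↦sq) Sb))
    ... | yes _ | no ¬Srq = p∉S (↦-closed⇒all S S-forward s₀∈C s₀∈S p∈C)
      where
      S-forward : ∀ {a b} → a ↦ b → S a → S b
      S-forward a↦b Sa with attached Sa (↦⇒E a↦b)
      ... | inj₁ Sb            = Sb
      ... | inj₂ (inj₁ refl)   = ⊥-elim (p≁S Sa (inj₂ a↦b))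
      ... | inj₂ (inj₂ refl)   = ⊥-elim (¬Srq (subst S (↦-injective a↦b rq↦q) Sa))
    ... | yes Ssq | yes _ with ↦-closed⇒all (λ w → S w ⊎ w ≡ q) S∪q-forward s₀∈C (inj₁ s₀∈S) p∈C
      where
      S∪q-forward : ∀ {a b} → a ↦ b → S a ⊎ a ≡ q → S b ⊎ b ≡ q
      S∪q-forward a↦b (inj₁ Sa) with attached Sa (↦⇒E a↦b)
      ... | inj₁ Sb            = inj₁ Sb
      ... | inj₂ (inj₁ refl)   = ⊥-elim (p≁S Sa (inj₂ a↦b))
      ... | inj₂ (inj₂ refl)   = inj₂ refl
      S∪q-forward a↦b (inj₂ refl) = inj₁ (subst S (↦-functional q↦sq a↦b) Ssq)
    ... | inj₁ Sp = p∉S Sp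
    ... | inj₂ p≡q = p≢q p≡q

    enters : ∃ λ t → S t × p ~ t
    enters with next p∈C | prev p∈C
    ... | s , p↦s | r , r↦p with S? s | S? r
    ... | yes Ss | _      = s , Ss , inj₁ p↦s
    ... | no _   | yes Sr = r , Sr , inj₂ r↦p
    ... | no ¬Ss | no ¬Sr = ⊥-elim (p-touches-S p≁S)
      where
      p≁S : ∀ {t} → S t → ¬ p ~ t
      p≁S St (inj₁ p↦t) = ¬Ss (subst S (↦-functional p↦t p↦s) St)
      p≁S St (inj₂ t↦p) = ¬Sr (subst S (↦-injective t↦p r↦p) St)

    exits : ∀ {o} → o ∈ C → ¬ S o → o ≢ p → o ≢ q → ∃ λ t → q ~ t × ¬ S t
    exits {o} o∈C ¬So o≢p o≢q with next q∈C | prev q∈C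
    ... | sq , q↦sq | rq , rq↦q with S? sq | S? rq
    ... | no ¬Ssq | _      = sq , inj₁ q↦sq , ¬Ssq
    ... | yes _   | no ¬Srq = rq , inj₂ rq↦q , ¬Srq
    ... | yes Ssq | yes Srq with enters
    ... | t , St , inj₁ p↦t = ⊥-elim (∉S∪pq ¬So o≢p o≢q (↦-closed⇒all S∪pq forward s₀∈C (inj₁ s₀∈S) o∈C))
      where
      forward : ∀ {a b} → a ↦ b → S∪pq a → S∪pq b
      forward a↦b (inj₁ Sa)          = attached Sa (↦⇒E a↦b)
      forward a↦b (inj₂ (inj₁ refl)) = inj₁ (subst S (↦-functional p↦t a↦b) St)
      forward a↦b (inj₂ (inj₂ refl)) = inj₁ (subst S (↦-functional q↦sq a↦b) Ssq)
    ... | t , St , inj₂ t↦p = ⊥-elim (↤-closed⇒all S∪pq backward s₀∈C (inj₁ s₀∈S) o∈C (∉S∪pq ¬So o≢p o≢q))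
      where
      backward : ∀ {a b} → a ↦ b → S∪pq b → S∪pq a
      backward a↦b (inj₁ Sb)          = attached Sb (E-sym (↦⇒E a↦b))
      backward a↦b (inj₂ (inj₁ refl)) = inj₁ (subst S (↦-injective t↦p a↦b) St)
      backward a↦b (inj₂ (inj₂ refl)) = inj₁ (subst S (↦-injective rq↦q a↦b) Srq)

module ℋ (m : ℕ) (a : Fin (3 + m) → ℕ) (b : (i : Fin (3 + m)) → suc (toℕ i) < 3 + m → ℕ) where

  k : ℕ
  k = 3 + m

  open HGraph k a b public

  G : Graph
  G = H k a b

  Adj-sym : ∀ {s t} → Adj s t → Adj t s
  Adj-sym = Sum.swap

  index : (j : ℕ) → suc j < k → Fin k
  index j h = fromℕ< (<-trans (n<1+n j) h)

  toℕ-index : ∀ j h → toℕ (index j h) ≡ j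
  toℕ-index j h = toℕ-fromℕ< _

  index-< : ∀ j h → suc (toℕ (index j h)) < k
  index-< j h = subst (λ n → suc n < k) (sym (toℕ-index j h)) h

  -- Fin indices are shifted by one against the paper: iₖ, iₖ₋₁ and u₁ carry the paper's indices k, k - 1 and 1.
  iₖ : Fin k
  iₖ = fromℕ (2 + m)

  iₖ₋₁ : Fin k
  iₖ₋₁ = index (1 + m) ≤-refl

  u₁ : Vtx
  u₁ = u fzero

  toℕ-iₖ : toℕ iₖ ≡ 2 + m
  toℕ-iₖ = toℕ-fromℕ (2 + m)

  toℕ-iₖ₋₁ : toℕ iₖ₋₁ ≡ 1 + m
  toℕ-iₖ₋₁ = toℕ-index (1 + m) ≤-refl

  suc-toℕ-iₖ : suc (toℕ iₖ) ≡ k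
  suc-toℕ-iₖ = cong suc toℕ-iₖ

  suc-toℕ-iₖ₋₁ : suc (toℕ iₖ₋₁) ≡ toℕ iₖ
  suc-toℕ-iₖ₋₁ = trans (cong suc toℕ-iₖ₋₁) (sym toℕ-iₖ)

  iₖ₋₁-< : suc (toℕ iₖ₋₁) < k
  iₖ₋₁-< = index-< (1 + m) ≤-refl

  iₖ-maximal : ¬ suc (toℕ iₖ) < k
  iₖ-maximal h = <⇒≢ h suc-toℕ-iₖ

  nothing-above-iₖ : ∀ {j} → suc (toℕ iₖ) ≢ toℕ j
  nothing-above-iₖ {j} e = <⇒≢ (toℕ<n j) (trans (sym e) suc-toℕ-iₖ)

  iₖ-or-below : ∀ i → i ≡ iₖ ⊎ toℕ i < 2 + m
  iₖ-or-below i with m≤n⇒m<n∨m≡n (≤-pred (toℕ<n i))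
  ... | inj₁ i<  = inj₂ i<
  ... | inj₂ i≡  = inj₁ (toℕ-injective (trans i≡ (sym toℕ-iₖ)))

  suc≡k⇒iₖ : ∀ {i} → suc (toℕ i) ≡ k → i ≡ iₖ
  suc≡k⇒iₖ e = toℕ-injective (trans (suc-injective e) (sym toℕ-iₖ))

  suc≡iₖ⇒iₖ₋₁ : ∀ {i} → suc (toℕ i) ≡ toℕ iₖ → i ≡ iₖ₋₁
  suc≡iₖ⇒iₖ₋₁ e = toℕ-injective (suc-injective (trans e (sym suc-toℕ-iₖ₋₁)))

  data Side : Set where
    uSide vSide : Side

  flip : Side → Side
  flip uSide = vSide
  flip vSide = uSide

  end : Side → Fin k → Vtx
  end uSide = u
  end vSide = v

  cliqueSize : Side → (i : Fin k) → suc (toℕ i) < k → ℕ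
  cliqueSize uSide i h = a i
  cliqueSize vSide i h = b i h

  cliqueVertex : (s : Side) (i : Fin k) (h : suc (toℕ i) < k) → Fin (cliqueSize s i h) → Vtx
  cliqueVertex uSide i h = cu i
  cliqueVertex vSide i h = cv i h

  clique : Side → (i : Fin k) → suc (toℕ i) < k → List Vtx
  clique s i h = tabulate (cliqueVertex s i h)

  block : Side → (i : Fin k) → suc (toℕ i) < k → List Vtx → List Vtx
  block s i h r = end s i ∷ clique s i h ++ x i ∷ clique (flip s) i h ++ end (flip s) i ∷ r

  -- Sides alternate so that consecutive blocks are joined by a path edge u_{i+1} u_i or v_{i+1} v_i.
  blocks : Side → (n : ℕ) → n < k → List Vtx → List Vtx
  blocks s zero    _ tl = tl
  blocks s (suc j) h tl = block s (index j h) (index-< j h) (blocks (flip s) j (<-trans (n<1+n j) h) tl)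

  tour : List Vtx → Side → List Vtx → List Vtx
  tour mid s tl = x iₖ ∷ tabulate (cu iₖ) ++ u iₖ ∷ mid ++ blocks s (2 + m) (n<1+n _) tl

  hamiltonian short : List Vtx
  hamiltonian = tour (z ∷ v iₖ ∷ []) vSide []
  short       = tour [] uSide []

  end-x : ∀ s i j → Adj (end s i) (x j)
  end-x uSide i j = inj₂ (xu j i)
  end-x vSide i j = inj₂ (xv j i)

  end-clique : ∀ s i h p → Adj (end s i) (cliqueVertex s i h p)
  end-clique uSide i h p = inj₂ cuu
  end-clique vSide i h p = inj₂ cvv

  clique-x : ∀ s i h p → Adj (cliqueVertex s i h p) (x i)
  clique-x uSide i h p = inj₁ cux
  clique-x vSide i h p = inj₁ cvx

  clique-clique : ∀ s i h p q → toℕ p < toℕ q → Adj (cliqueVertex s i h p) (cliqueVertex s i h q)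
  clique-clique uSide i h p q p<q = inj₁ (cucu p<q)
  clique-clique vSide i h p q p<q = inj₁ (cvcv p<q)

  end-end : ∀ s j h h′ → Adj (end s (index (suc j) h)) (end s (index j h′))
  end-end uSide j h h′ = inj₂ (uu (trans (cong suc (toℕ-index j h′)) (sym (toℕ-index (suc j) h))))
  end-end vSide j h h′ = inj₁ (vv (trans (cong suc (toℕ-index j h′)) (sym (toℕ-index (suc j) h))))

  block-linked : ∀ s i h {r} → Linked Adj (end (flip s) i ∷ r) → Linked Adj (block s i h r)
  block-linked s i h linked =
    Linked-clique Adj (cliqueVertex s i h) (end-clique s i h) (clique-x s i h) (clique-clique s i h) (end-x s i i)
      (Linked-clique Adj (cliqueVertex (flip s) i h) (Adj-sym ∘ clique-x (flip s) i h)
        (Adj-sym ∘ end-clique (flip s) i h) (clique-clique (flip s) i h) (Adj-sym (end-x (flip s) i i)) linked)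

  blocks-linked : ∀ s j h → Linked Adj (blocks s (suc j) h [ x iₖ ])
  blocks-linked s zero    h = block-linked s _ _ (end-x (flip s) _ iₖ ∷ [-])
  blocks-linked s (suc j) h = block-linked s _ _ (end-end (flip s) j h h′ ∷ blocks-linked (flip s) j h′)
    where h′ = <-trans (n<1+n (suc j)) h

  block-++ : ∀ s i h r e → block s i h r ++ e ≡ block s i h (r ++ e)
  block-++ s i h r e = cong (end s i ∷_) (begin
      (A ++ x i ∷ B ++ end (flip s) i ∷ r) ++ e   ≡⟨ ++-assoc A _ e ⟩
      A ++ x i ∷ (B ++ end (flip s) i ∷ r) ++ e   ≡⟨ cong (λ l → A ++ x i ∷ l) (++-assoc B _ e) ⟩
      A ++ x i ∷ B ++ end (flip s) i ∷ r ++ e     ∎)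
    where
    open ≡-Reasoning
    A = clique s i h
    B = clique (flip s) i h

  blocks-++ : ∀ s n h tl e → blocks s n h tl ++ e ≡ blocks s n h (tl ++ e)
  blocks-++ s zero    h tl e = refl
  blocks-++ s (suc j) h tl e = trans (block-++ s _ _ _ e) (cong (block s _ _) (blocks-++ (flip s) j _ tl e))

  tour-++ : ∀ mid s e → tour mid s [] ++ e ≡ tour mid s e
  tour-++ mid s e = cong (x iₖ ∷_) (begin
      (Kₖ ++ u iₖ ∷ mid ++ lower []) ++ e   ≡⟨ ++-assoc Kₖ _ e ⟩
      Kₖ ++ u iₖ ∷ (mid ++ lower []) ++ e   ≡⟨ cong (λ l → Kₖ ++ u iₖ ∷ l) (++-assoc mid _ e) ⟩
      Kₖ ++ u iₖ ∷ mid ++ lower [] ++ e     ≡⟨ cong (λ l → Kₖ ++ u iₖ ∷ mid ++ l) (blocks-++ s (2 + m) _ [] e) ⟩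
      Kₖ ++ u iₖ ∷ mid ++ lower e           ∎)
    where
    open ≡-Reasoning
    Kₖ = tabulate (cu iₖ)
    lower = blocks s (2 + m) (n<1+n _)

  tour-linked : ∀ mid s → Linked Adj (u iₖ ∷ mid ++ blocks s (2 + m) (n<1+n _) [ x iₖ ]) →
    Linked Adj (tour mid s [] ++ [ x iₖ ])
  tour-linked mid s linked = subst (Linked Adj) (sym (tour-++ mid s [ x iₖ ]))
    (Linked-clique Adj (cu iₖ) (λ _ → inj₂ cux) (λ _ → inj₁ cuu) (λ _ _ → inj₁ ∘ cucu) (inj₁ (xu iₖ iₖ)) linked)

  hamiltonian-linked : Linked Adj (hamiltonian ++ [ x iₖ ])
  hamiltonian-linked = tour-linked (z ∷ v iₖ ∷ []) vSide
    (inj₁ (uz suc-toℕ-iₖ) ∷ inj₁ (zv suc-toℕ-iₖ) ∷ inj₁ (vv suc-toℕ-iₖ₋₁) ∷ blocks-linked vSide (1 + m) (n<1+n _))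

  short-linked : Linked Adj (short ++ [ x iₖ ])
  short-linked = tour-linked [] uSide (inj₂ (uu suc-toℕ-iₖ₋₁) ∷ blocks-linked uSide (1 + m) (n<1+n _))

  data Kind : Set where
    kx ku kz kv kcu kcv : Kind

  kind : Vtx → Kind
  kind (x _)      = kx
  kind (u _)      = ku
  kind z          = kz
  kind (v _)      = kv
  kind (cu _ _)   = kcu
  kind (cv _ _ _) = kcv

  level : Vtx → ℕ
  level (x i)      = toℕ i
  level (u i)      = toℕ i
  level z          = k
  level (v i)      = toℕ i
  level (cu i _)   = toℕ i
  level (cv i _ _) = toℕ i

  -- Within a block all vertices share a level and differ in kind (or in the position in a clique),
  -- and the levels decrease from block to block.
  tag : Vtx → Kind × ℕ
  tag w = kind w , level w

  Apart : Kind × ℕ → Vtx → Set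
  Apart c w = tag w ≢ c

  below⇒apart : ∀ {n κ r} → All (λ w → level w < n) r → All (Apart (κ , n)) r
  below⇒apart = All.map λ lt eq → <⇒≢ lt (cong proj₂ eq)

  ∷-unique : ∀ {w c r} → tag w ≡ c → All (Apart c) r → Unique r → Unique (w ∷ r)
  ∷-unique tw apart ur = Unique-++-separatedBy tag (tw ∷ []) apart ([] ∷ []) ur

  tabulate-unique : ∀ {n c r} (f : Fin n → Vtx) → (∀ {p q} → f p ≡ f q → p ≡ q) → (∀ p → tag (f p) ≡ c) →
    All (Apart c) r → Unique r → Unique (tabulate f ++ r)
  tabulate-unique f f-injective f-tag apart =
    Unique-++-separatedBy tag (All.tabulate⁺ f-tag) apart (Unique.tabulate⁺ f-injective)

  tabulate-apart : ∀ {n c r} (f : Fin n → Vtx) → (∀ p → Apart c (f p)) → All (Apart c) r → All (Apart c) (tabulate f ++ r)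
  tabulate-apart f f-apart r-apart = All.++⁺ (All.tabulate⁺ f-apart) r-apart

  block-unique : ∀ s i h {r} → All (λ w → level w < toℕ i) r → Unique r → Unique (block s i h r)
  block-unique uSide i h {r} r< ur =
    ∷-unique refl (tabulate-apart (cu i) (λ _ ()) ((λ ()) ∷ tabulate-apart (cv i h) (λ _ ()) ((λ ()) ∷ r♯)))
      (tabulate-unique (cu i) (λ { refl → refl }) (λ _ → refl) ((λ ()) ∷ tabulate-apart (cv i h) (λ _ ()) ((λ ()) ∷ r♯))
        (∷-unique refl (tabulate-apart (cv i h) (λ _ ()) ((λ ()) ∷ r♯))
          (tabulate-unique (cv i h) (λ { refl → refl }) (λ _ → refl) ((λ ()) ∷ r♯)
            (∷-unique refl r♯ ur))))
    where
    r♯ : ∀ {κ} → All (Apart (κ , toℕ i)) r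
    r♯ = below⇒apart r<
  block-unique vSide i h {r} r< ur =
    ∷-unique refl (tabulate-apart (cv i h) (λ _ ()) ((λ ()) ∷ tabulate-apart (cu i) (λ _ ()) ((λ ()) ∷ r♯)))
      (tabulate-unique (cv i h) (λ { refl → refl }) (λ _ → refl) ((λ ()) ∷ tabulate-apart (cu i) (λ _ ()) ((λ ()) ∷ r♯))
        (∷-unique refl (tabulate-apart (cu i) (λ _ ()) ((λ ()) ∷ r♯))
          (tabulate-unique (cu i) (λ { refl → refl }) (λ _ → refl) ((λ ()) ∷ r♯)
            (∷-unique refl r♯ ur))))
    where
    r♯ : ∀ {κ} → All (Apart (κ , toℕ i)) r
    r♯ = below⇒apart r<

  block-levels : ∀ s i h {r} (P : ℕ → Set) → P (toℕ i) → All (P ∘ level) r → All (P ∘ level) (block s i h r)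
  block-levels uSide i h P Pi Pr = Pi ∷ All.++⁺ (All.tabulate⁺ λ _ → Pi) (Pi ∷ All.++⁺ (All.tabulate⁺ λ _ → Pi) (Pi ∷ Pr))
  block-levels vSide i h P Pi Pr = Pi ∷ All.++⁺ (All.tabulate⁺ λ _ → Pi) (Pi ∷ All.++⁺ (All.tabulate⁺ λ _ → Pi) (Pi ∷ Pr))

  blocks-below : ∀ s n h → All (λ w → level w < n) (blocks s n h [])
  blocks-below s zero    h = []
  blocks-below s (suc j) h =
    block-levels s _ _ (_< suc j) (s≤s (≤-reflexive (toℕ-index j h))) (All.map m<n⇒m<1+n (blocks-below (flip s) j _))

  blocks-unique : ∀ s n h → Unique (blocks s n h [])
  blocks-unique s zero    h = []
  blocks-unique s (suc j) h = block-unique s _ _ rest-below (blocks-unique (flip s) j h′)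
    where
    h′ = <-trans (n<1+n j) h
    rest-below : All (λ w → level w < toℕ (index j h)) (blocks (flip s) j h′ [])
    rest-below = subst (λ n → All (λ w → level w < n) (blocks (flip s) j h′ [])) (sym (toℕ-index j h)) (blocks-below (flip s) j h′)

  lower-below-iₖ : ∀ s → All (λ w → level w < toℕ iₖ) (blocks s (2 + m) (n<1+n _) [])
  lower-below-iₖ s = subst (λ n → All (λ w → level w < n) (blocks s (2 + m) (n<1+n _) [])) (sym toℕ-iₖ) (blocks-below s (2 + m) _)

  lower-below-k : ∀ s → All (λ w → level w < k) (blocks s (2 + m) (n<1+n _) [])
  lower-below-k s = All.map m<n⇒m<1+n (blocks-below s (2 + m) _)

  hamiltonian-unique : Unique hamiltonian
  hamiltonian-unique =
    ∷-unique refl (tabulate-apart (cu iₖ) (λ _ ()) ((λ ()) ∷ (λ ()) ∷ (λ ()) ∷ lower♯))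
      (tabulate-unique (cu iₖ) (λ { refl → refl }) (λ _ → refl) ((λ ()) ∷ (λ ()) ∷ (λ ()) ∷ lower♯)
        (∷-unique refl ((λ ()) ∷ (λ ()) ∷ lower♯)
          (∷-unique refl ((λ ()) ∷ below⇒apart (lower-below-k vSide))
            (∷-unique refl lower♯ (blocks-unique vSide _ _)))))
    where
    lower♯ : ∀ {κ} → All (Apart (κ , toℕ iₖ)) (blocks vSide (2 + m) (n<1+n _) [])
    lower♯ = below⇒apart (lower-below-iₖ vSide)

  short-unique-with-z-vₖ : Unique (z ∷ v iₖ ∷ short)
  short-unique-with-z-vₖ =
    ∷-unique refl ((λ ()) ∷ (λ ()) ∷ tabulate-apart (cu iₖ) (λ _ ()) ((λ ()) ∷ below⇒apart (lower-below-k uSide)))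
      (∷-unique refl ((λ ()) ∷ tabulate-apart (cu iₖ) (λ _ ()) ((λ ()) ∷ lower♯))
        (∷-unique refl (tabulate-apart (cu iₖ) (λ _ ()) ((λ ()) ∷ lower♯))
          (tabulate-unique (cu iₖ) (λ { refl → refl }) (λ _ → refl) ((λ ()) ∷ lower♯)
            (∷-unique refl lower♯ (blocks-unique uSide _ _)))))
    where
    lower♯ : ∀ {κ} → All (Apart (κ , toℕ iₖ)) (blocks uSide (2 + m) (n<1+n _) [])
    lower♯ = below⇒apart (lower-below-iₖ uSide)

  data InBlock (i : Fin k) : Vtx → Set where
    at-x  : InBlock i (x i)
    at-u  : InBlock i (u i)
    at-v  : InBlock i (v i)
    at-cu : ∀ p → InBlock i (cu i p)
    at-cv : ∀ h p → InBlock i (cv i h p)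

  module _ (s : Side) (i : Fin k) (h : suc (toℕ i) < k) (r : List Vtx) where

    private
      A = clique s i h
      B = clique (flip s) i h

    ∈-block-first : ∀ {w} → w ∈ A → w ∈ block s i h r
    ∈-block-first w∈ = there (∈-++⁺ˡ w∈)

    x∈block : x i ∈ block s i h r
    x∈block = there (∈-++⁺ʳ A (here refl))

    ∈-block-second : ∀ {w} → w ∈ B → w ∈ block s i h r
    ∈-block-second w∈ = there (∈-++⁺ʳ A (there (∈-++⁺ˡ w∈)))

    flip-end∈block : end (flip s) i ∈ block s i h r
    flip-end∈block = there (∈-++⁺ʳ A (there (∈-++⁺ʳ B (here refl))))

    ∈-block-tail : ∀ {w} → w ∈ r → w ∈ block s i h r
    ∈-block-tail w∈ = there (∈-++⁺ʳ A (there (∈-++⁺ʳ B (there w∈))))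

  cv∈clique : ∀ i h h′ p → cv i h′ p ∈ clique vSide i h
  cv∈clique i h h′ p rewrite <-irrelevant h h′ = ∈-tabulate⁺ p

  ∈-block : ∀ s i h r {w} → InBlock i w → w ∈ block s i h r
  ∈-block s     i h r at-x          = x∈block s i h r
  ∈-block uSide i h r at-u          = here refl
  ∈-block vSide i h r at-u          = flip-end∈block vSide i h r
  ∈-block uSide i h r at-v          = flip-end∈block uSide i h r
  ∈-block vSide i h r at-v          = here refl
  ∈-block uSide i h r (at-cu p)     = ∈-block-first uSide i h r (∈-tabulate⁺ p)
  ∈-block vSide i h r (at-cu p)     = ∈-block-second vSide i h r (∈-tabulate⁺ p)
  ∈-block uSide i h r (at-cv h′ p)  = ∈-block-second uSide i h r (cv∈clique i h h′ p)
  ∈-block vSide i h r (at-cv h′ p)  = ∈-block-first vSide i h r (cv∈clique i h h′ p)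

  ∈-blocks : ∀ s n h tl {i w} → toℕ i < n → InBlock i w → w ∈ blocks s n h tl
  ∈-blocks s (suc j) h tl {i} i<n w∈ with m≤n⇒m<n∨m≡n (≤-pred i<n)
  ... | inj₁ i<j = ∈-block-tail s _ _ _ (∈-blocks (flip s) j _ tl i<j w∈)
  ... | inj₂ i≡j with toℕ-injective {i = i} {j = index j h} (trans i≡j (sym (toℕ-index j h)))
  ...   | refl = ∈-block s _ _ _ w∈

  module _ (mid : List Vtx) (s : Side) where

    private
      Kₖ = tabulate (cu iₖ)

    ∈-tour-lower : ∀ {i w} → toℕ i < 2 + m → InBlock i w → w ∈ tour mid s []
    ∈-tour-lower i< w∈ = there (∈-++⁺ʳ Kₖ (there (∈-++⁺ʳ mid (∈-blocks s (2 + m) _ [] i< w∈))))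

    ∈-tour-mid : ∀ {w} → w ∈ mid → w ∈ tour mid s []
    ∈-tour-mid w∈ = there (∈-++⁺ʳ Kₖ (there (∈-++⁺ˡ w∈)))

    ∈-tour : ∀ w → (w ≡ z → w ∈ mid) → (w ≡ v iₖ → w ∈ mid) → w ∈ tour mid s []
    ∈-tour (x i) _ _ with iₖ-or-below i
    ... | inj₁ refl = here refl
    ... | inj₂ i<   = ∈-tour-lower i< at-x
    ∈-tour (u i) _ _ with iₖ-or-below i
    ... | inj₁ refl = there (∈-++⁺ʳ Kₖ (here refl))
    ... | inj₂ i<   = ∈-tour-lower i< at-u
    ∈-tour z z∈ _ = ∈-tour-mid (z∈ refl)
    ∈-tour (v i) _ vₖ∈ with iₖ-or-below i
    ... | inj₁ refl = ∈-tour-mid (vₖ∈ refl)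
    ... | inj₂ i<   = ∈-tour-lower i< at-v
    ∈-tour (cu i p) _ _ with iₖ-or-below i
    ... | inj₁ refl = there (∈-++⁺ˡ (∈-tabulate⁺ p))
    ... | inj₂ i<   = ∈-tour-lower i< (at-cu p)
    ∈-tour (cv i h p) _ _ = ∈-tour-lower (≤-pred h) (at-cv h p)

  hamiltonian-spanning : ∀ w → w ∈ hamiltonian
  hamiltonian-spanning w = ∈-tour (z ∷ v iₖ ∷ []) vSide w (λ { refl → here refl }) (λ { refl → there (here refl) })

  ∈-short : ∀ w → w ≢ z → w ≢ v iₖ → w ∈ short
  ∈-short w w≢z w≢vₖ = ∈-tour [] uSide w (⊥-elim ∘ w≢z) (⊥-elim ∘ w≢vₖ)

  hamiltonian-cycle : IsCycle G hamiltonian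
  hamiltonian-cycle = three≤length (tabulate (cu iₖ)) {x iₖ} {u iₖ} {z} , hamiltonian-unique , hamiltonian-linked

  short-cycle : IsCycle G short
  short-cycle = three≤length (tabulate (cu iₖ)) {x iₖ} {u iₖ} {u iₖ₋₁} ,
                AllPairs.tail (AllPairs.tail short-unique-with-z-vₖ) , short-linked

  z∉short : ¬ z ∈ short
  z∉short z∈ = All.lookup (AllPairs.head short-unique-with-z-vₖ) (there z∈) refl

  data Kᵘ (i : Fin k) : Vtx → Set where
    on-cu : ∀ p → Kᵘ i (cu i p)

  data Kᵛ (i : Fin k) : Vtx → Set where
    on-cv : ∀ h p → Kᵛ i (cv i h p)

  Kᵘ? : ∀ i → Decidable (Kᵘ i)
  Kᵘ? i (cu j p) with j ≟ i
  ... | yes refl = yes (on-cu p)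
  ... | no j≢i   = no λ { (on-cu _) → j≢i refl }
  Kᵘ? i (x _)      = no λ ()
  Kᵘ? i (u _)      = no λ ()
  Kᵘ? i z          = no λ ()
  Kᵘ? i (v _)      = no λ ()
  Kᵘ? i (cv _ _ _) = no λ ()

  Kᵛ? : ∀ i → Decidable (Kᵛ i)
  Kᵛ? i (cv j h p) with j ≟ i
  ... | yes refl = yes (on-cv h p)
  ... | no j≢i   = no λ { (on-cv _ _) → j≢i refl }
  Kᵛ? i (x _)    = no λ ()
  Kᵛ? i (u _)    = no λ ()
  Kᵛ? i z        = no λ ()
  Kᵛ? i (v _)    = no λ ()
  Kᵛ? i (cu _ _) = no λ ()

  Kᵘ-attached : ∀ i {s t} → Kᵘ i s → Adj s t → Kᵘ i t ⊎ t ≡ x i ⊎ t ≡ u i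
  Kᵘ-attached i (on-cu p) (inj₁ (cucu _)) = inj₁ (on-cu _)
  Kᵘ-attached i (on-cu p) (inj₁ cux)      = inj₂ (inj₁ refl)
  Kᵘ-attached i (on-cu p) (inj₁ cuu)      = inj₂ (inj₂ refl)
  Kᵘ-attached i (on-cu p) (inj₂ (cucu _)) = inj₁ (on-cu _)

  Kᵛ-attached : ∀ i {s t} → Kᵛ i s → Adj s t → Kᵛ i t ⊎ t ≡ x i ⊎ t ≡ v i
  Kᵛ-attached i (on-cv h p) (inj₁ (cvcv _)) = inj₁ (on-cv _ _)
  Kᵛ-attached i (on-cv h p) (inj₁ cvx)      = inj₂ (inj₁ refl)
  Kᵛ-attached i (on-cv h p) (inj₁ cvv)      = inj₂ (inj₂ refl)
  Kᵛ-attached i (on-cv h p) (inj₂ (cvcv _)) = inj₁ (on-cv _ _)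

  module NoExtension (a≥1 : ∀ i → 1 ≤ a i) (b≥1 : ∀ i h → 1 ≤ b i h)
    {v₀ ws} (cycle′ : IsCycle G (v₀ ∷ ws)) (short⊆ : ∀ w → w ∈ short → w ∈ v₀ ∷ ws) where

    open OnCycle G Adj-sym cycle′

    ∈C : ∀ w → w ≢ z → w ≢ v iₖ → w ∈ C
    ∈C w w≢z w≢vₖ = short⊆ w (∈-short w w≢z w≢vₖ)

    v∈C : ∀ i → suc (toℕ i) < k → v i ∈ C
    v∈C i h = ∈C (v i) (λ ()) λ { refl → iₖ-maximal h }

    u₁∈C : u₁ ∈ C
    u₁∈C = ∈C u₁ (λ ()) (λ ())

    module Kᵘ-from-x (i : Fin k) = PastedClique (Kᵘ i) (Kᵘ? i) (Kᵘ-attached i)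
      (∈C (x i) (λ ()) (λ ())) (∈C (u i) (λ ()) (λ ())) (λ ()) (λ ()) (λ ())
      (on-cu (fromℕ< (a≥1 i))) (∈C _ (λ ()) (λ ()))

    module Kᵘ-from-u (i : Fin k) = PastedClique (Kᵘ i) (Kᵘ? i) (λ Ks st → Sum.map₂ Sum.swap (Kᵘ-attached i Ks st))
      (∈C (u i) (λ ()) (λ ())) (∈C (x i) (λ ()) (λ ())) (λ ()) (λ ()) (λ ())
      (on-cu (fromℕ< (a≥1 i))) (∈C _ (λ ()) (λ ()))

    module Kᵛ-from-x (i : Fin k) (h : suc (toℕ i) < k) = PastedClique (Kᵛ i) (Kᵛ? i) (Kᵛ-attached i)
      (∈C (x i) (λ ()) (λ ())) (v∈C i h) (λ ()) (λ ()) (λ ())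
      (on-cv h (fromℕ< (b≥1 i h))) (∈C _ (λ ()) (λ ()))

    module Kᵛ-from-v (i : Fin k) (h : suc (toℕ i) < k) = PastedClique (Kᵛ i) (Kᵛ? i) (λ Ks st → Sum.map₂ Sum.swap (Kᵛ-attached i Ks st))
      (v∈C i h) (∈C (x i) (λ ()) (λ ())) (λ ()) (λ ()) (λ ())
      (on-cv h (fromℕ< (b≥1 i h))) (∈C _ (λ ()) (λ ()))

    x-neighbour : ∀ i → suc (toℕ i) < k → ∀ {t} → x i ~ t → Kᵘ i t ⊎ Kᵛ i t
    x-neighbour i h x~t with Kᵘ-from-x.enters i | Kᵛ-from-x.enters i h
    ... | _ , on-cu p , x~cu | _ , on-cv h′ q , x~cv with ~-at-most-two x~cu x~cv (λ ()) x~t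
    ... | inj₁ refl = inj₁ (on-cu p)
    ... | inj₂ refl = inj₂ (on-cv h′ q)

    x-outside-cliques⇒iₖ : ∀ {i t} → x i ~ t → ¬ Kᵘ i t → ¬ Kᵛ i t → i ≡ iₖ
    x-outside-cliques⇒iₖ {i} x~t ¬Kᵘ ¬Kᵛ with iₖ-or-below i
    ... | inj₁ i≡iₖ = i≡iₖ
    ... | inj₂ i<   with x-neighbour i (s≤s i<) x~t
    ...   | inj₁ Kᵘt = ⊥-elim (¬Kᵘ Kᵘt)
    ...   | inj₂ Kᵛt = ⊥-elim (¬Kᵛ Kᵛt)

    module Without-vₖ (z∈C : z ∈ C) (vₖ∉C : ¬ v iₖ ∈ C) where

      z-neighbour : ∀ {t} → z ~ t → t ≡ x iₖ ⊎ t ≡ u iₖ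
      z-neighbour z~t with ~⇒E z~t
      ... | inj₁ (zv e) with suc≡k⇒iₖ e
      ...   | refl = ⊥-elim (vₖ∉C (~-target z~t))
      z-neighbour z~t | inj₂ (xz i) with x-outside-cliques⇒iₖ (~-sym z~t) (λ ()) (λ ())
      ...   | refl = inj₁ refl
      z-neighbour z~t | inj₂ (uz e) with suc≡k⇒iₖ e
      ...   | refl = inj₂ refl

      z~xₖ×z~uₖ : z ~ x iₖ × z ~ u iₖ
      z~xₖ×z~uₖ = ~-both z∈C (λ ()) z-neighbour

      xₖ-neighbour : ∀ {t} → x iₖ ~ t → t ≡ z ⊎ Kᵘ iₖ t
      xₖ-neighbour = ~-either (Kᵘ iₖ) (~-sym (proj₁ z~xₖ×z~uₖ)) (λ ()) (Kᵘ-from-x.enters iₖ)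

      uₖ-neighbour : ∀ {t} → u iₖ ~ t → t ≡ z ⊎ Kᵘ iₖ t
      uₖ-neighbour = ~-either (Kᵘ iₖ) (~-sym (proj₂ z~xₖ×z~uₖ)) (λ ()) (Kᵘ-from-u.enters iₖ)

      data Region : Vtx → Set where
        at-z   : Region z
        at-xₖ  : Region (x iₖ)
        at-uₖ  : Region (u iₖ)
        in-Kᵘₖ : ∀ {w} → Kᵘ iₖ w → Region w

      closed : ∀ {s t} → s ~ t → Region s → Region t
      closed z~t at-z with z-neighbour z~t
      ... | inj₁ refl = at-xₖ
      ... | inj₂ refl = at-uₖ
      closed x~t at-xₖ with xₖ-neighbour x~t
      ... | inj₁ refl = at-z
      ... | inj₂ K    = in-Kᵘₖ K
      closed u~t at-uₖ with uₖ-neighbour u~t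
      ... | inj₁ refl = at-z
      ... | inj₂ K    = in-Kᵘₖ K
      closed s~t (in-Kᵘₖ K) with Kᵘ-attached iₖ K (~⇒E s~t)
      ... | inj₁ K′           = in-Kᵘₖ K′
      ... | inj₂ (inj₁ refl) = at-xₖ
      ... | inj₂ (inj₂ refl) = at-uₖ

      u₁∉Region : ¬ Region u₁
      u₁∉Region (in-Kᵘₖ ())

    module Without-z (vₖ∈C : v iₖ ∈ C) (z∉C : ¬ z ∈ C) where

      vₖ-neighbour : ∀ {t} → v iₖ ~ t → t ≡ x iₖ ⊎ t ≡ v iₖ₋₁
      vₖ-neighbour vₖ~t with ~⇒E vₖ~t
      ... | inj₁ (vv e) with suc≡iₖ⇒iₖ₋₁ e
      ...   | refl = inj₂ refl
      vₖ-neighbour vₖ~t | inj₂ (xv i _) with x-outside-cliques⇒iₖ (~-sym vₖ~t) (λ ()) (λ ())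
      ...   | refl = inj₁ refl
      vₖ-neighbour vₖ~t | inj₂ (zv _)         = ⊥-elim (z∉C (~-target vₖ~t))
      vₖ-neighbour vₖ~t | inj₂ (vv e)         = ⊥-elim (nothing-above-iₖ e)
      vₖ-neighbour vₖ~t | inj₂ (cvv {h = h})  = ⊥-elim (iₖ-maximal h)

      vₖ~xₖ×vₖ~vₖ₋₁ : v iₖ ~ x iₖ × v iₖ ~ v iₖ₋₁
      vₖ~xₖ×vₖ~vₖ₋₁ = ~-both vₖ∈C (λ ()) vₖ-neighbour

      xₖ-neighbour : ∀ {t} → x iₖ ~ t → t ≡ v iₖ ⊎ Kᵘ iₖ t
      xₖ-neighbour = ~-either (Kᵘ iₖ) (~-sym (proj₁ vₖ~xₖ×vₖ~vₖ₋₁)) (λ ()) (Kᵘ-from-x.enters iₖ)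

      vₖ₋₁-neighbour : ∀ {t} → v iₖ₋₁ ~ t → t ≡ v iₖ ⊎ Kᵛ iₖ₋₁ t
      vₖ₋₁-neighbour = ~-either (Kᵛ iₖ₋₁) (~-sym (proj₂ vₖ~xₖ×vₖ~vₖ₋₁)) (λ ()) (Kᵛ-from-v.enters iₖ₋₁ iₖ₋₁-<)

      uₖ-neighbour : ∀ {t} → u iₖ ~ t → t ≡ u iₖ₋₁ ⊎ Kᵘ iₖ t
      uₖ-neighbour uₖ~t with ~⇒E uₖ~t
      ... | inj₁ (uu e) = ⊥-elim (nothing-above-iₖ e)
      ... | inj₁ (uz _) = ⊥-elim (z∉C (~-target uₖ~t))
      ... | inj₂ cuu    = inj₂ (on-cu _)
      ... | inj₂ (uu e) with suc≡iₖ⇒iₖ₋₁ e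
      ...   | refl = inj₁ refl
      uₖ-neighbour uₖ~t | inj₂ (xu i _) with x-outside-cliques⇒iₖ (~-sym uₖ~t) (λ ()) (λ ())
      ...   | refl with xₖ-neighbour (~-sym uₖ~t)
      ...     | inj₁ ()
      ...     | inj₂ ()

      uₖ~uₖ₋₁ : u iₖ ~ u iₖ₋₁
      uₖ~uₖ₋₁ with Kᵘ-from-x.exits iₖ u₁∈C (λ ()) (λ ()) (λ ())
      ... | t , uₖ~t , t∉Kᵘ with uₖ-neighbour uₖ~t
      ...   | inj₁ refl = uₖ~t
      ...   | inj₂ Kᵘt  = ⊥-elim (t∉Kᵘ Kᵘt)

      uₖ₋₁-neighbour : ∀ {t} → u iₖ₋₁ ~ t → t ≡ u iₖ ⊎ Kᵘ iₖ₋₁ t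
      uₖ₋₁-neighbour = ~-either (Kᵘ iₖ₋₁) (~-sym uₖ~uₖ₋₁) (λ ()) (Kᵘ-from-u.enters iₖ₋₁)

      data Region : Vtx → Set where
        at-vₖ    : Region (v iₖ)
        at-xₖ    : Region (x iₖ)
        at-uₖ    : Region (u iₖ)
        at-vₖ₋₁  : Region (v iₖ₋₁)
        at-xₖ₋₁  : Region (x iₖ₋₁)
        at-uₖ₋₁  : Region (u iₖ₋₁)
        in-Kᵘₖ   : ∀ {w} → Kᵘ iₖ w → Region w
        in-Kᵘₖ₋₁ : ∀ {w} → Kᵘ iₖ₋₁ w → Region w
        in-Kᵛₖ₋₁ : ∀ {w} → Kᵛ iₖ₋₁ w → Region w

      closed : ∀ {s t} → s ~ t → Region s → Region t
      closed s~t at-vₖ with vₖ-neighbour s~t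
      ... | inj₁ refl = at-xₖ
      ... | inj₂ refl = at-vₖ₋₁
      closed s~t at-xₖ with xₖ-neighbour s~t
      ... | inj₁ refl = at-vₖ
      ... | inj₂ K    = in-Kᵘₖ K
      closed s~t at-uₖ with uₖ-neighbour s~t
      ... | inj₁ refl = at-uₖ₋₁
      ... | inj₂ K    = in-Kᵘₖ K
      closed s~t at-vₖ₋₁ with vₖ₋₁-neighbour s~t
      ... | inj₁ refl = at-vₖ
      ... | inj₂ K    = in-Kᵛₖ₋₁ K
      closed s~t at-xₖ₋₁ with x-neighbour iₖ₋₁ iₖ₋₁-< s~t
      ... | inj₁ K    = in-Kᵘₖ₋₁ K
      ... | inj₂ K    = in-Kᵛₖ₋₁ K
      closed s~t at-uₖ₋₁ with uₖ₋₁-neighbour s~t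
      ... | inj₁ refl = at-uₖ
      ... | inj₂ K    = in-Kᵘₖ₋₁ K
      closed s~t (in-Kᵘₖ K) with Kᵘ-attached iₖ K (~⇒E s~t)
      ... | inj₁ K′           = in-Kᵘₖ K′
      ... | inj₂ (inj₁ refl) = at-xₖ
      ... | inj₂ (inj₂ refl) = at-uₖ
      closed s~t (in-Kᵘₖ₋₁ K) with Kᵘ-attached iₖ₋₁ K (~⇒E s~t)
      ... | inj₁ K′           = in-Kᵘₖ₋₁ K′
      ... | inj₂ (inj₁ refl) = at-xₖ₋₁
      ... | inj₂ (inj₂ refl) = at-uₖ₋₁
      closed s~t (in-Kᵛₖ₋₁ K) with Kᵛ-attached iₖ₋₁ K (~⇒E s~t)
      ... | inj₁ K′           = in-Kᵛₖ₋₁ K′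
      ... | inj₂ (inj₁ refl) = at-xₖ₋₁
      ... | inj₂ (inj₂ refl) = at-vₖ₋₁

      u₁∉Region : ¬ Region u₁
      u₁∉Region (in-Kᵘₖ ())
      u₁∉Region (in-Kᵘₖ₋₁ ())
      u₁∉Region (in-Kᵛₖ₋₁ ())

    z-without-vₖ : z ∈ C → ¬ v iₖ ∈ C → ⊥
    z-without-vₖ z∈C vₖ∉C = u₁∉Region (~-closed⇒all Region closed z∈C at-z u₁∈C)
      where open Without-vₖ z∈C vₖ∉C

    vₖ-without-z : v iₖ ∈ C → ¬ z ∈ C → ⊥
    vₖ-without-z vₖ∈C z∉C = u₁∉Region (~-closed⇒all Region closed vₖ∈C at-vₖ u₁∈C)
      where open Without-z vₖ∈C z∉C

    -- By counting, C′ contains exactly one of z and v iₖ, and both cases are excluded above.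
    one-vertex-more-impossible : length C ≢ suc (length short)
    one-vertex-more-impossible |C|≡ = ¬¬vₖ∈C λ vₖ∈C → vₖ-without-z vₖ∈C λ z∈C → not-both z∈C vₖ∈C
      where
      not-both : z ∈ C → v iₖ ∈ C → ⊥
      not-both z∈C vₖ∈C = 1+n≰n (subst (suc (suc (length short)) ≤_) |C|≡
        (Unique-⊆⇒length≤ short-unique-with-z-vₖ λ where
          (here refl)         → z∈C
          (there (here refl)) → vₖ∈C
          (there (there w∈))  → short⊆ _ w∈))

      not-neither : ¬ z ∈ C → ¬ v iₖ ∈ C → ⊥
      not-neither z∉C vₖ∉C = 1+n≰n (subst (_≤ length short) |C|≡
        (Unique-⊆⇒length≤ C-unique λ {w} w∈C →
          ∈-short w (λ { refl → z∉C w∈C }) (λ { refl → vₖ∉C w∈C })))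

      ¬¬vₖ∈C : ¬ ¬ v iₖ ∈ C
      ¬¬vₖ∈C vₖ∉C = not-neither (λ z∈C → z-without-vₖ z∈C vₖ∉C) vₖ∉C

  not-extendible : (∀ i → 1 ≤ a i) → (∀ i h → 1 ≤ b i h) → ¬ CycleExtendible G
  not-extendible a≥1 b≥1 extend with extend short short-cycle (λ spanning → z∉short (spanning z))
  ... | v₀ ∷ ws , cycle′ , short⊆ , |C′| = NoExtension.one-vertex-more-impossible a≥1 b≥1 cycle′ short⊆ |C′|

theorem2p7 : (k : ℕ) → 3 ≤ k →
    (a : Fin k → ℕ) (b : (i : Fin k) → suc (toℕ i) < k → ℕ) →
    (∀ i → 1 ≤ a i) → (∀ i h → 1 ≤ b i h) →
    Hamiltonian (H k a b) × ¬ CycleExtendible (H k a b)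
theorem2p7 (suc (suc (suc m))) (s≤s (s≤s (s≤s z≤n))) a b a≥1 b≥1 =
  (hamiltonian , hamiltonian-cycle , hamiltonian-spanning) , not-extendible a≥1 b≥1
  where open ℋ m a b
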